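{- Let $A,B,C$ be nonempty pairwise disjoint sets with $A$ finite, and let $f:A\cup B\to A\cup C$ be injective. Then for every $b\in B$ there exists $n(b)\in\mathbb{N}$ with $f^{n(b)}(b)\in C$ and $f^{\nu}(b)\in A$ for $1\le\nu\le n(b)-1$, and the map $F:B\to C$, $b\mapsto f^{n(b)}(b)$, is injective.
   Context: $\mathbb{N}=\{1,2,\dots\}$. Iterates are defined by $f^0(a)=a$ and $f^{i+1}(a)=f(f^i(a))$ whenever $f^i(a)$ lies in the domain $A\cup B$ of $f$. -}

module Defs where

open import Data.Nat using (ℕ; zero; suc)
open import Data.Sum using (_⊎_; inj₁; inj₂)
open import Data.Maybe using (Maybe; just; nothing; _>>=_)

-- The pairwise disjoint sets A, B, C are modelled as types; A ∪ B is A ⊎ B,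
-- A ∪ C is A ⊎ C, and A ∪ B ∪ C is A ⊎ (B ⊎ C).

step : {A B C : Set} → (A ⊎ B → A ⊎ C) → A ⊎ (B ⊎ C) → Maybe (A ⊎ (B ⊎ C))
step f (inj₁ a) with f (inj₁ a)
... | inj₁ a' = just (inj₁ a')
... | inj₂ c  = just (inj₂ (inj₂ c))
step f (inj₂ (inj₁ b)) with f (inj₂ b)
... | inj₁ a' = just (inj₁ a')
... | inj₂ c  = just (inj₂ (inj₂ c))
step f (inj₂ (inj₂ c)) = nothing

iter : {A B C : Set} → (A ⊎ B → A ⊎ C) → ℕ → A ⊎ (B ⊎ C) → Maybe (A ⊎ (B ⊎ C))
iter f zero    x = just x
iter f (suc i) x = iter f i x >>= step f

module Submission where

-- Extend f to a total map on A ∪ B ∪ C that fixes C pointwise; its orbits agree with the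
-- partial iterates as long as they stay in A ∪ B, and since f never maps into B, the orbit
-- of b ∈ B leaves B at once. If it stayed in A for k + 1 steps, two of those points would
-- coincide (|A| = k), and cancelling the common number of steps by injectivity would bring
-- the orbit back to b, which it never revisits. So it reaches C after n(b) ≥ 1 steps.
-- Likewise, if F b = F b′ with n(b) ≤ n(b′), cancelling n(b) steps gives
-- f^{n(b′) − n(b)}(b′) = b, which forces n(b′) = n(b) and b′ = b.

open import Defs
open import Data.Nat using (ℕ; zero; suc; _+_; _≤_; _<_; z≤n; s≤s)
open import Data.Nat.Properties
  using (≤-refl; <⇒≤; <-≤-trans; n≤1+n; m≤n⇒m<n∨m≡n; +-monoˡ-<; +-suc; ≤-total; m≤n⇒∃[o]m+o≡n)
open import Data.Fin using (Fin; toℕ)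
open import Data.Fin.Properties using (pigeonhole; toℕ<n)
open import Data.Sum using (_⊎_; inj₁; inj₂)
open import Data.Sum.Properties using (inj₁-injective; inj₂-injective)
open import Data.Product using (Σ; ∃; _×_; _,_; proj₁; proj₂)
open import Data.Maybe using (just)
open import Data.Empty using (⊥; ⊥-elim)
open import Function.Base using (_∘_)
open import Function.Bundles using (_↔_; Injection)
open import Function.Properties.Inverse using (↔⇒↣)
open import Function.Definitions using (Injective)
open import Relation.Nullary using (¬_)
open import Relation.Binary.PropositionalEquality
  using (_≡_; _≢_; refl; sym; trans; cong; subst; module ≡-Reasoning)

pattern atA a = inj₁ a
pattern atB b = inj₂ (inj₁ b)
pattern atC c = inj₂ (inj₂ c)

module Orbit {A B C : Set} (f : A ⊎ B → A ⊎ C) where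

  fromDom : A ⊎ B → A ⊎ (B ⊎ C)
  fromDom (inj₁ a) = atA a
  fromDom (inj₂ b) = atB b

  fromCodom : A ⊎ C → A ⊎ (B ⊎ C)
  fromCodom (inj₁ a) = atA a
  fromCodom (inj₂ c) = atC c

  data InDom : A ⊎ (B ⊎ C) → Set where
    dom : (u : A ⊎ B) → InDom (fromDom u)

  next : A ⊎ (B ⊎ C) → A ⊎ (B ⊎ C)
  next (atA a) = fromCodom (f (inj₁ a))
  next (atB b) = fromCodom (f (inj₂ b))
  next (atC c) = atC c

  orbit : A ⊎ (B ⊎ C) → ℕ → A ⊎ (B ⊎ C)
  orbit x zero    = x
  orbit x (suc n) = next (orbit x n)

  InDom-before : ℕ → A ⊎ (B ⊎ C) → Set
  InDom-before n x = ∀ ν → ν < n → InDom (orbit x ν)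

  InDom-before-mono : ∀ {m n x} → m ≤ n → InDom-before n x → InDom-before m x
  InDom-before-mono m≤n h ν ν<m = h ν (<-≤-trans ν<m m≤n)

  next-fromDom : ∀ u → next (fromDom u) ≡ fromCodom (f u)
  next-fromDom (inj₁ a) = refl
  next-fromDom (inj₂ b) = refl

  step-next : ∀ {x} → InDom x → step f x ≡ just (next x)
  step-next (dom (inj₁ a)) with f (inj₁ a)
  ... | inj₁ a′ = refl
  ... | inj₂ c  = refl
  step-next (dom (inj₂ b)) with f (inj₂ b)
  ... | inj₁ a′ = refl
  ... | inj₂ c  = refl

  iter-orbit : ∀ {n x} → InDom-before n x → iter f n x ≡ just (orbit x n)
  iter-orbit {zero}  h = refl
  iter-orbit {suc n} h
    rewrite iter-orbit {n} (InDom-before-mono (n≤1+n n) h) = step-next (h n ≤-refl)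

  orbit-+ : ∀ m d x → orbit x (m + d) ≡ orbit (orbit x d) m
  orbit-+ zero    d x = refl
  orbit-+ (suc m) d x = cong next (orbit-+ m d x)

  fromCodom-avoids-B : ∀ u {b} → fromCodom u ≢ atB b
  fromCodom-avoids-B (inj₁ a) ()
  fromCodom-avoids-B (inj₂ c) ()

  next-avoids-B : ∀ x {b} → next x ≢ atB b
  next-avoids-B (atA a) = fromCodom-avoids-B (f (inj₁ a))
  next-avoids-B (atB b) = fromCodom-avoids-B (f (inj₂ b))
  next-avoids-B (atC c) ()

  orbit-avoids-B : ∀ x n {b} → orbit x (suc n) ≢ atB b
  orbit-avoids-B x n = next-avoids-B (orbit x n)

  orbit≡atB⇒start : ∀ d {x b} → orbit x d ≡ atB b → x ≡ atB b
  orbit≡atB⇒start zero        e = e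
  orbit≡atB⇒start (suc d) {x} e = ⊥-elim (orbit-avoids-B x d e)

  InA-until : B → ℕ → Set
  InA-until b t = ∀ ν → 1 ≤ ν → ν < t → ∃ λ a → orbit (atB b) ν ≡ atA a

  InA-until⇒InDom-before : ∀ {b t} → InA-until b t → InDom-before t (atB b)
  InA-until⇒InDom-before {b} h zero    _   = dom (inj₂ b)
  InA-until⇒InDom-before     h (suc ν) ν<t with h (suc ν) (s≤s z≤n) ν<t
  ... | a , e = subst InDom (sym e) (dom (inj₁ a))

  InA-until-extend : ∀ {b t a} → InA-until b t → orbit (atB b) t ≡ atA a → InA-until b (suc t)
  InA-until-extend {a = a} h e ν 1≤ν (s≤s ν≤t) with m≤n⇒m<n∨m≡n ν≤t
  ... | inj₁ ν<t  = h ν 1≤ν ν<t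
  ... | inj₂ refl = a , e

  record Exit (b : B) : Set where
    field
      time      : ℕ
      target    : C
      hits      : orbit (atB b) time ≡ atC target
      inA-until : InA-until b time

  open Exit public

  time-positive : ∀ {b} (E : Exit b) → 1 ≤ time E
  time-positive E with time E | hits E
  ... | zero  | ()
  ... | suc _ | _ = s≤s z≤n

  exit-iter : ∀ {b} (E : Exit b) →
    iter f (time E) (atB b) ≡ just (atC (target E))
    × (∀ ν → 1 ≤ ν → ν < time E → ∃ λ a → iter f ν (atB b) ≡ just (atA a))
  exit-iter {b} E = trans (iter-orbit inDom) (cong just (hits E)) , inA
    where
    inDom : InDom-before (time E) (atB b)
    inDom = InA-until⇒InDom-before (inA-until E)
    inA : ∀ ν → 1 ≤ ν → ν < time E → ∃ λ a → iter f ν (atB b) ≡ just (atA a)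
    inA ν 1≤ν ν<t with inA-until E ν 1≤ν ν<t
    ... | a , e = a , trans (iter-orbit (InDom-before-mono (<⇒≤ ν<t) inDom)) (cong just e)

  exit-or-InA : ∀ b t → Exit b ⊎ InA-until b (suc t)
  exit-or-InA b zero = inj₂ λ { zero () _ ; (suc _) _ (s≤s ()) }
  exit-or-InA b (suc t) with exit-or-InA b t
  ... | inj₁ E = inj₁ E
  ... | inj₂ h with orbit (atB b) (suc t) in e
  ...   | atA a = inj₂ (InA-until-extend h e)
  ...   | atB _ = ⊥-elim (orbit-avoids-B (atB b) t e)
  ...   | atC c = inj₁ record { time = suc t ; target = c ; hits = e ; inA-until = h }

  module _ (f-injective : Injective _≡_ _≡_ f) where

    fromCodom-injective : ∀ u v → fromCodom u ≡ fromCodom v → u ≡ v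
    fromCodom-injective (inj₁ a) (inj₁ a′) refl = refl
    fromCodom-injective (inj₂ c) (inj₂ c′) refl = refl

    next-injective : ∀ {x y} → InDom x → InDom y → next x ≡ next y → x ≡ y
    next-injective (dom u) (dom v) e =
      cong fromDom (f-injective (fromCodom-injective (f u) (f v) (begin
        fromCodom (f u)  ≡⟨ sym (next-fromDom u) ⟩
        next (fromDom u) ≡⟨ e ⟩
        next (fromDom v) ≡⟨ next-fromDom v ⟩
        fromCodom (f v)  ∎)))
      where open ≡-Reasoning

    orbit-injective : ∀ m {x y} → InDom-before m x → InDom-before m y →
      orbit x m ≡ orbit y m → x ≡ y
    orbit-injective zero    _  _  e = e
    orbit-injective (suc m) hx hy e =
      orbit-injective m (InDom-before-mono (n≤1+n m) hx) (InDom-before-mono (n≤1+n m) hy)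
        (next-injective (hx m ≤-refl) (hy m ≤-refl) e)

    orbit-cancel : ∀ {m d n x y} → m + d ≡ n → InDom-before n x → InDom-before m y →
      orbit x n ≡ orbit y m → orbit x d ≡ y
    orbit-cancel {m} {d} {x = x} refl hx hy e =
      orbit-injective m shifted hy (trans (sym (orbit-+ m d x)) e)
      where
      shifted : InDom-before m (orbit x d)
      shifted ν ν<m = subst InDom (orbit-+ ν d x) (hx (ν + d) (+-monoˡ-< d ν<m))

    exits-with-same-target : ∀ {b b′} (E : Exit b) (E′ : Exit b′) →
      time E ≤ time E′ → target E ≡ target E′ → b ≡ b′
    exits-with-same-target E E′ t≤t′ same with m≤n⇒∃[o]m+o≡n t≤t′
    ... | d , t+d≡t′ =
      sym (inj₁-injective (inj₂-injective (orbit≡atB⇒start d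
        (orbit-cancel t+d≡t′ (InA-until⇒InDom-before (inA-until E′))
          (InA-until⇒InDom-before (inA-until E))
          (trans (hits E′) (trans (cong atC (sym same)) (sym (hits E))))))))

    exit-target-injective : (E : ∀ b → Exit b) → Injective _≡_ _≡_ (target ∘ E)
    exit-target-injective E {b} {b′} same with ≤-total (time (E b)) (time (E b′))
    ... | inj₁ t≤t′ = exits-with-same-target (E b) (E b′) t≤t′ same
    ... | inj₂ t′≤t = sym (exits-with-same-target (E b′) (E b) t′≤t (sym same))

    module _ {k : ℕ} (A↔Fin : A ↔ Fin k) where

      InA-until-bounded : ∀ {b} → ¬ InA-until b (suc (suc k))
      InA-until-bounded {b} h =
        let i , j , i<j , same = pigeonhole ≤-refl (Injection.to A↣Fin ∘ point)
        in no-repeat i j i<j (Injection.injective A↣Fin same)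
        where
        A↣Fin = ↔⇒↣ A↔Fin

        point : Fin (suc k) → A
        point i = proj₁ (h (suc (toℕ i)) (s≤s z≤n) (s≤s (toℕ<n i)))

        at : ∀ i → orbit (atB b) (suc (toℕ i)) ≡ atA (point i)
        at i = proj₂ (h (suc (toℕ i)) (s≤s z≤n) (s≤s (toℕ<n i)))

        inDom : ∀ i → InDom-before (suc (toℕ i)) (atB b)
        inDom i = InDom-before-mono (s≤s (<⇒≤ (toℕ<n i))) (InA-until⇒InDom-before h)

        no-repeat : ∀ i j → toℕ i < toℕ j → point i ≡ point j → ⊥
        no-repeat i j i<j same with m≤n⇒∃[o]m+o≡n i<j
        ... | e , i+1+e≡j = orbit-avoids-B (atB b) e (orbit-cancel steps (inDom j) (inDom i) loop)
          where
          steps : suc (toℕ i) + suc e ≡ suc (toℕ j)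
          steps = trans (+-suc (suc (toℕ i)) e) (cong suc i+1+e≡j)
          loop : orbit (atB b) (suc (toℕ j)) ≡ orbit (atB b) (suc (toℕ i))
          loop = trans (at j) (sym (trans (at i) (cong atA same)))

      exit : ∀ b → Exit b
      exit b with exit-or-InA b (suc k)
      ... | inj₁ E = E
      ... | inj₂ h = ⊥-elim (InA-until-bounded h)

lemma5 : (A B C : Set) → (k : ℕ) → A ↔ Fin k → A → B → C →
    (f : A ⊎ B → A ⊎ C) → Injective _≡_ _≡_ f →
    Σ (B → ℕ) λ n → Σ (B → C) λ F →
      ((b : B) →
        (1 ≤ n b)
        × (iter f (n b) (inj₂ (inj₁ b)) ≡ just (inj₂ (inj₂ (F b))))
        × ((ν : ℕ) → 1 ≤ ν → ν < n b →
             ∃ λ a → iter f ν (inj₂ (inj₁ b)) ≡ just (inj₁ a)))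
      × Injective _≡_ _≡_ F
lemma5 A B C k A↔Fin _ _ _ f f-injective =
  time ∘ E , target ∘ E , (λ b → time-positive (E b) , exit-iter (E b)) ,
  exit-target-injective f-injective E
  where
  open Orbit f
  E : ∀ b → Exit b
  E = exit f-injective A↔Fin
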